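{- Let $G$ be a binary quasigroup of order $n$. Then the period of the equivalence class $\mathcal U_1$ is at most $2$. Moreover, every permutation $W\in\mathcal W$ and every constant tuple $\mathbf a=(a,\dots,a)$, $a\in\mathcal I_n$, belongs to $\mathcal U_1$.
   Context: Let $\mathcal I_n=\{1,\dots,n\}$. A binary quasigroup $G$ of order $n$ is $\mathcal I_n$ with an operation $*$ such that for all $a_0,a_1,a_2$ there are unique $x_1,x_2$ with $a_1*x_2=a_0$, $x_1*a_2=a_0$. Elements of $\mathcal I_n^n$ are tuples; $*$ acts entrywise. A permutation is a tuple with pairwise distinct entries; $\mathcal W$ is the set of permutations and $\mathbb W=(1,\dots,n)$. For $d\ge0$, a $U$-diagonal of type $V$ in $G[d]$ is a sequence $(W_1,\dots,W_d)\in\mathcal W^d$ with $(\cdots((U*W_1)*W_2)*\cdots)*W_d=V$ entrywise. Tuples $U,V$ are equivalent if for some $d\ge0$ there is a $U$-diagonal of type $V$ in $G[d]$; $\mathcal U_1$ is the equivalence class containing $\mathbb W$. The period of a class $\mathcal U$ is the gcd of all $d\ge1$ such that some $U\in\mathcal U$ admits a $U$-diagonal of type $U$ in $G[d]$. -}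

module Defs where

open import Data.Nat using (ℕ; zero; suc; _≤_)
open import Data.Nat.Divisibility using (_∣_)
open import Data.Fin using (Fin; toℕ)
open import Data.Vec using (Vec; []; _∷_)
open import Data.Product using (Σ; ∃; ∃-syntax; ∃!; _×_; _,_; proj₁)
open import Function.Definitions using (Injective)
open import Relation.Binary.PropositionalEquality using (_≡_)

-- I_n is modelled as Fin n (element k of I_n is the Fin n element with toℕ = k-1).

record Quasigroup (n : ℕ) : Set where
  field
    _∙_      : Fin n → Fin n → Fin n
    left-div  : ∀ (a₁ a₀ : Fin n) → ∃! _≡_ (λ x₂ → a₁ ∙ x₂ ≡ a₀)
    right-div : ∀ (a₂ a₀ : Fin n) → ∃! _≡_ (λ x₁ → x₁ ∙ a₂ ≡ a₀)

Tuple : ℕ → Set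
Tuple n = Fin n → Fin n

_≐_ : ∀ {n} → Tuple n → Tuple n → Set
U ≐ V = ∀ i → U i ≡ V i

Perm : ℕ → Set
Perm n = Σ (Tuple n) (λ W → Injective _≡_ _≡_ W)

𝕎 : ∀ {n} → Tuple n
𝕎 i = i

const : ∀ {n} → Fin n → Tuple n
const a _ = a

module _ {n : ℕ} (G : Quasigroup n) where
  open Quasigroup G

  _⊛_ : Tuple n → Tuple n → Tuple n
  (U ⊛ W) i = U i ∙ W i

  act : ∀ {d} → Tuple n → Vec (Perm n) d → Tuple n
  act U []       = U
  act U (W ∷ Ws) = act (U ⊛ proj₁ W) Ws

  Diagonal : ℕ → Tuple n → Tuple n → Set
  Diagonal d U V = Σ (Vec (Perm n) d) (λ Ws → act U Ws ≐ V)

  Equiv : Tuple n → Tuple n → Set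
  Equiv U V = ∃[ d ] Diagonal d U V

  InU₁ : Tuple n → Set
  InU₁ U = Equiv 𝕎 U

  ReturnLength : ℕ → Set
  ReturnLength d = (1 ≤ d) × ∃[ U ] (InU₁ U × Diagonal d U U)

  -- p is the gcd of the set of return lengths (gcd of the empty set is 0).
  IsPeriodU₁ : ℕ → Set
  IsPeriodU₁ p = (∀ d → ReturnLength d → p ∣ d)
               × (∀ g → (∀ d → ReturnLength d → g ∣ d) → g ∣ p)

-- For every a, the identity tuple 𝕎 reaches the constant tuple (a,…,a) in one step, and the
-- constant tuple reaches every permutation in one step; hence 2 is a return length of 𝒰₁ and
-- the period divides 2. To exhibit the period one has to decide whether 𝒰₁ has an odd return
-- length. Tuples are vertices of a finite graph, so this is the decidable question whether
-- some vertex reachable from 𝕎 lies on an odd closed walk, i.e. whether (U , even) reaches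
-- (U , odd) in the graph doubled by a parity bit; in a finite graph a shortest walk is
-- shorter than the number of vertices, which bounds the search.
module Submission where

open import Defs
open import Data.Nat using (ℕ; _≤_)
open import Data.Fin using (Fin)
open import Data.Product using (Σ; ∃; ∃-syntax; _×_; proj₁)

open import Data.Bool using (Bool; true; false; not)
open import Data.Bool.Properties using (not-involutive) renaming (_≟_ to _≟ᵇ_)
open import Data.Empty using (⊥-elim)
open import Data.Fin as Fin using (zero; suc; funToFin; finToFun)
open import Data.Fin.Properties using (any?; all?; pigeonhole; finToFun-funToFin; 2↔Bool; *↔×)
  renaming (_≟_ to _≟ᶠ_)
open import Data.Nat using (zero; suc; _*_; _^_; _<_; _<?_; z≤n; s≤s; s<s; anyUpTo?)
open import Data.Nat.Divisibility using (_∣_; divides; ∣-trans; 1∣_; n∣m*n; ∣m+n∣m⇒∣n)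
open import Data.Nat.Induction using (<-wellFounded)
open import Data.Nat.Properties using (+-comm; ≤-refl; ≮⇒≥; m<n⇒m<1+n)
open import Data.Product using (_,_; proj₂)
open import Data.Product.Function.NonDependent.Propositional using (_×-↩_)
open import Data.Sum using (_⊎_; inj₁; inj₂)
open import Data.Vec using (Vec; []; _∷_; lookup; tabulate)
open import Data.Vec.Properties using (lookup∘tabulate; tabulate∘lookup; tabulate-cong)
open import Function using (_∘_; _↩_; Inverse; LeftInverse; mk↩)
open import Function.Construct.Composition using (_↩-∘_)
open import Function.Consequences.Propositional using (strictlyInverseˡ⇒inverseˡ)
open import Function.Definitions using (Injective)
open import Induction.WellFounded using (Acc; acc)
open import Relation.Nullary using (Dec; yes; no)
open import Relation.Nullary.Decidable using (map′; _×-dec_; _→-dec_)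
open import Relation.Binary.PropositionalEquality

flips : ℕ → Bool → Bool
flips zero    b = b
flips (suc d) b = flips d (not b)

Odd : ℕ → Set
Odd d = ∃[ j ] d ≡ suc (j * 2)

even-or-odd : ∀ d → 2 ∣ d ⊎ Odd d
even-or-odd zero = inj₁ (divides 0 refl)
even-or-odd (suc d) with even-or-odd d
... | inj₁ (divides j refl) = inj₂ (j , refl)
... | inj₂ (j , refl)       = inj₁ (divides (suc j) refl)

flips-even : ∀ j b → flips (j * 2) b ≡ b
flips-even zero    b = refl
flips-even (suc j) b = trans (flips-even j (not (not b))) (not-involutive b)

odd⇒flips : ∀ {d} → Odd d → flips d false ≡ true
odd⇒flips (j , refl) = flips-even j true

flips⇒odd : ∀ {d} → flips d false ≡ true → Odd d
flips⇒odd {d} flipped with even-or-odd d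
... | inj₁ (divides j refl) with () ← trans (sym (flips-even j false)) flipped
... | inj₂ odd = odd

∣2∧∣odd⇒∣1 : ∀ {g d} → g ∣ 2 → g ∣ d → Odd d → g ∣ 1
∣2∧∣odd⇒∣1 {g} g∣2 g∣d (j , refl) =
  ∣m+n∣m⇒∣n (subst (g ∣_) (+-comm 1 (j * 2)) g∣d) (∣-trans g∣2 (n∣m*n j))

module FiniteGraph {V : Set} {m : ℕ} (finite : Fin m ↩ V)
                   (_⇒_ : V → V → Set) (_⇒?_ : ∀ u v → Dec (u ⇒ v)) where

  open LeftInverse finite using (strictlyInverseˡ) renaming (to to enum; from to index)

  index-injective : ∀ {u v} → index u ≡ index v → u ≡ v
  index-injective {u} {v} eq =
    trans (sym (strictlyInverseˡ u)) (trans (cong enum eq) (strictlyInverseˡ v))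

  _≟_ : ∀ (u v : V) → Dec (u ≡ v)
  u ≟ v = map′ index-injective (cong index) (index u ≟ᶠ index v)

  any-vertex? : {P : V → Set} → (∀ v → Dec (P v)) → Dec (∃ P)
  any-vertex? {P} P? = map′ (λ (i , p) → enum i , p)
    (λ (v , p) → index v , subst P (sym (strictlyInverseˡ v)) p) (any? (P? ∘ enum))

  infixr 5 _∷_
  data Path : ℕ → V → V → Set where
    []  : ∀ {v} → Path 0 v v
    _∷_ : ∀ {d u w v} → u ⇒ w → Path d w v → Path (suc d) u v

  vertex : ∀ {d u v} → Path d u v → Fin (suc d) → V
  vertex {u = u} _ zero    = u
  vertex (_ ∷ p)   (suc i) = vertex p i

  ShorterPath : ℕ → V → V → Set
  ShorterPath d u v = ∃[ k ] k < d × Path k u v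

  path-from-vertex : ∀ {d u v} (p : Path d u v) (i : Fin d) → ShorterPath d (vertex p (suc i)) v
  path-from-vertex (_ ∷ p) zero    = _ , ≤-refl , p
  path-from-vertex (_ ∷ p) (suc i) with k , k<d , q ← path-from-vertex p i = k , m<n⇒m<1+n k<d , q

  shortcut : ∀ {d u v} (p : Path d u v) {i j : Fin (suc d)} →
             i Fin.< j → vertex p i ≡ vertex p j → ShorterPath d u v
  shortcut p       {zero}  {suc j} _ eq with k , k<d , q ← path-from-vertex p j =
    k , k<d , subst (λ x → Path k x _) (sym eq) q
  shortcut (e ∷ p) {suc i} {suc j} (s<s i<j) eq with k , k<d , q ← shortcut p i<j eq =
    suc k , s<s k<d , e ∷ q

  shorten : ∀ {d u v} → Path d u v → ShorterPath m u v
  shorten p = go (<-wellFounded _) p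
    where
    go : ∀ {d u v} → Acc _<_ d → Path d u v → ShorterPath m u v
    go {d} (acc smaller) p with d <? m
    ... | yes d<m = d , d<m , p
    ... | no d≮m with i , j , i<j , same ← pigeonhole (s<s (≮⇒≥ d≮m)) (index ∘ vertex p)
                 with k , k<d , q ← shortcut p i<j (index-injective same) = go (smaller k<d) q

  path? : ∀ d u v → Dec (Path d u v)
  path? zero    u v = map′ (λ { refl → [] }) (λ { [] → refl }) (u ≟ v)
  path? (suc d) u v = map′ (λ (_ , e , p) → e ∷ p) (λ { (e ∷ p) → _ , e , p })
    (any-vertex? λ w → (u ⇒? w) ×-dec path? d w v)

  Reachable : V → V → Set
  Reachable u v = ∃[ d ] Path d u v

  reachable? : ∀ u v → Dec (Reachable u v)
  reachable? u v = map′ (λ (k , _ , p) → k , p) (shorten ∘ proj₂)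
    (anyUpTo? (λ k → path? k u v) m)

module OddCycles {V : Set} {m : ℕ} (finite : Fin m ↩ V)
                 (_⇒_ : V → V → Set) (_⇒?_ : ∀ u v → Dec (u ⇒ v)) where

  open FiniteGraph finite _⇒_ _⇒?_ public

  _⇒₂_ : V × Bool → V × Bool → Set
  (u , b) ⇒₂ (v , c) = u ⇒ v × c ≡ not b

  finite₂ : Fin (m * 2) ↩ (V × Bool)
  finite₂ = (finite ×-↩ Inverse.leftInverse 2↔Bool) ↩-∘ Inverse.leftInverse *↔×

  module Doubled = FiniteGraph finite₂ _⇒₂_ (λ (u , b) (v , c) → (u ⇒? v) ×-dec (c ≟ᵇ not b))

  lift : ∀ {d u v} → Path d u v → ∀ b → Doubled.Path d (u , b) (v , flips d b)
  lift []      b = Doubled.[]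
  lift (e ∷ p) b = (e , refl) Doubled.∷ lift p (not b)

  project : ∀ {d u v b c} → Doubled.Path d (u , b) (v , c) → Path d u v × flips d b ≡ c
  project Doubled.[] = [] , refl
  project ((e , refl) Doubled.∷ q) with p , flipped ← project q = e ∷ p , flipped

  OddClosedWalk : V → Set
  OddClosedWalk u = ∃[ d ] Odd d × Path d u u

  oddClosedWalk? : ∀ u → Dec (OddClosedWalk u)
  oddClosedWalk? u = map′
    (λ (d , q) → let p , flipped = project q in d , flips⇒odd flipped , p)
    (λ (d , odd , p) → d , subst (λ c → Doubled.Path d (u , false) (u , c)) (odd⇒flips odd) (lift p false))
    (Doubled.reachable? (u , false) (u , true))

vectorEnumeration : ∀ {m k} → Fin (m ^ k) ↩ Vec (Fin m) k
vectorEnumeration = mk↩ {from = funToFin ∘ lookup} (strictlyInverseˡ⇒inverseˡ (tabulate ∘ finToFun) λ v →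
  trans (tabulate-cong (finToFun-funToFin (lookup v))) (tabulate∘lookup v))

identityPerm : ∀ {n} → Perm n
identityPerm = 𝕎 , λ eq → eq

module _ {n : ℕ} (G : Quasigroup n) where
  open Quasigroup G

  infixl 7 _╲_
  _╲_ : Fin n → Fin n → Fin n
  a ╲ b = proj₁ (left-div a b)

  ∙-╲ : ∀ a b → a ∙ (a ╲ b) ≡ b
  ∙-╲ a b = proj₁ (proj₂ (left-div a b))

  ╲-unique : ∀ {a b x} → a ∙ x ≡ b → a ╲ b ≡ x
  ╲-unique {a} {b} = proj₂ (proj₂ (left-div a b))

  ∙-cancelʳ : ∀ {a x y} → x ∙ a ≡ y ∙ a → x ≡ y
  ∙-cancelʳ {a} {x} eq = trans (sym (unique refl)) (unique (sym eq))
    where unique = proj₂ (proj₂ (right-div a (x ∙ a)))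

  infix 4 _⟶_
  _⟶_ : Tuple n → Tuple n → Set
  U ⟶ V = Σ (Perm n) λ W → ∀ i → U i ∙ proj₁ W i ≡ V i

  ⟶-resp : ∀ {U U′ V V′} → U ≐ U′ → V ≐ V′ → U ⟶ V → U′ ⟶ V′
  ⟶-resp U≐U′ V≐V′ (W , eq) = W , λ i →
    trans (cong (_∙ proj₁ W i) (sym (U≐U′ i))) (trans (eq i) (V≐V′ i))

  ╲-injective⇒⟶ : ∀ {U V} → Injective _≡_ _≡_ (λ i → U i ╲ V i) → U ⟶ V
  ╲-injective⇒⟶ {U} {V} injective = (_ , injective) , λ i → ∙-╲ (U i) (V i)

  ⟶⇒╲-injective : ∀ {U V} → U ⟶ V → Injective _≡_ _≡_ (λ i → U i ╲ V i)
  ⟶⇒╲-injective (W , eq) {i} {j} same =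
    proj₂ W (trans (sym (╲-unique (eq i))) (trans same (╲-unique (eq j))))

  _⟶?_ : ∀ U V → Dec (U ⟶ V)
  U ⟶? V = map′ (λ injective → ╲-injective⇒⟶ λ {i} {j} → injective i j)
    (λ step i j → ⟶⇒╲-injective step) (all? λ i → all? λ j → (U i ╲ V i ≟ᶠ U j ╲ V j) →-dec (i ≟ᶠ j))

  ⟶-const : ∀ {U} a → Injective _≡_ _≡_ U → U ⟶ const a
  ⟶-const {U} a U-injective = ╲-injective⇒⟶ λ {i} {j} same →
    U-injective (∙-cancelʳ (trans (∙-╲ (U i) a) (trans (sym (∙-╲ (U j) a)) (cong (U j ∙_) (sym same)))))

  const-⟶ : ∀ {V} a → Injective _≡_ _≡_ V → const a ⟶ V
  const-⟶ {V} a V-injective = ╲-injective⇒⟶ λ {i} {j} same →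
    V-injective (trans (sym (∙-╲ a (V i))) (trans (cong (a ∙_) same) (∙-╲ a (V j))))

  act-resp : ∀ {d U U′} (Ws : Vec (Perm n) d) → U ≐ U′ → act G U Ws ≐ act G U′ Ws
  act-resp []       U≐U′ = U≐U′
  act-resp (W ∷ Ws) U≐U′ = act-resp Ws λ i → cong (_∙ proj₁ W i) (U≐U′ i)

  diagonal-respˡ : ∀ {d U U′ V} → U ≐ U′ → Diagonal G d U V → Diagonal G d U′ V
  diagonal-respˡ U≐U′ (Ws , eq) = Ws , λ i → trans (act-resp Ws (sym ∘ U≐U′) i) (eq i)

  diagonal-refl : ∀ {U} → Diagonal G 0 U U
  diagonal-refl = [] , λ _ → refl

  infixr 5 _▸_
  _▸_ : ∀ {d U X V} → U ⟶ X → Diagonal G d X V → Diagonal G (suc d) U V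
  (W , eq) ▸ (Ws , eq′) = W ∷ Ws , λ i → trans (act-resp Ws eq i) (eq′ i)

  diagonal-via-const : Fin n → (W : Perm n) → Diagonal G 2 𝕎 (proj₁ W)
  diagonal-via-const a (W , W-injective) =
    ⟶-const a (λ eq → eq) ▸ const-⟶ a W-injective ▸ diagonal-refl

  const∈U₁ : ∀ a → InU₁ G (const a)
  const∈U₁ a = 1 , ⟶-const a (λ eq → eq) ▸ diagonal-refl

  -- Vertices are vectors rather than tuples so that they are compared by _≡_, not pointwise.
  _⇒_ : Vec (Fin n) n → Vec (Fin n) n → Set
  u ⇒ v = lookup u ⟶ lookup v

  open OddCycles vectorEnumeration _⇒_ (λ u v → lookup u ⟶? lookup v)

  diagonal⇒path : ∀ {d U V} → Diagonal G d U V → Path d (tabulate U) (tabulate V)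
  diagonal⇒path ([] , U≐V) = subst (Path 0 _) (tabulate-cong U≐V) []
  diagonal⇒path {U = U} (W ∷ Ws , eq) =
    ⟶-resp (sym ∘ lookup∘tabulate U) (sym ∘ lookup∘tabulate _) (W , λ _ → refl)
    ∷ diagonal⇒path (Ws , eq)

  path⇒diagonal : ∀ {d u v} → Path d u v → Diagonal G d (lookup u) (lookup v)
  path⇒diagonal []      = diagonal-refl
  path⇒diagonal (e ∷ p) = e ▸ path⇒diagonal p

  oddReturnLength? : Dec (∃[ d ] ReturnLength G d × Odd d)
  oddReturnLength? = map′
    (λ (u , (k , 𝕎→u) , (d , odd , u→u)) →
      d , (odd⇒positive odd , lookup u ,
           (k , diagonal-respˡ (lookup∘tabulate 𝕎) (path⇒diagonal 𝕎→u)) , path⇒diagonal u→u) , odd)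
    (λ (d , (_ , U , (k , 𝕎→U) , U→U) , odd) →
      tabulate U , (k , diagonal⇒path 𝕎→U) , (d , odd , diagonal⇒path U→U))
    (any-vertex? λ u → reachable? (tabulate 𝕎) u ×-dec oddClosedWalk? u)
    where
    odd⇒positive : ∀ {d} → Odd d → 1 ≤ d
    odd⇒positive (_ , refl) = s≤s z≤n

  2-returnLength : Diagonal G 2 𝕎 𝕎 → ReturnLength G 2
  2-returnLength 𝕎→𝕎 = s≤s z≤n , 𝕎 , (0 , diagonal-refl) , 𝕎→𝕎

  period≤2 : Diagonal G 2 𝕎 𝕎 → ∃[ p ] (IsPeriodU₁ G p × p ≤ 2)
  period≤2 𝕎→𝕎 with oddReturnLength?
  ... | yes (d , returns , odd) = 1 , ((λ d _ → 1∣ d) , λ g divides-all →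
    ∣2∧∣odd⇒∣1 (divides-all 2 (2-returnLength 𝕎→𝕎)) (divides-all d returns) odd) , s≤s z≤n
  ... | no ¬odd = 2 , (even , λ g divides-all → divides-all 2 (2-returnLength 𝕎→𝕎)) , ≤-refl
    where
    even : ∀ d → ReturnLength G d → 2 ∣ d
    even d returns with even-or-odd d
    ... | inj₁ 2∣d = 2∣d
    ... | inj₂ odd = ⊥-elim (¬odd (d , returns , odd))

𝕎-returns-in-two : ∀ n (G : Quasigroup n) → Diagonal G 2 𝕎 𝕎
𝕎-returns-in-two zero    G = identityPerm ∷ identityPerm ∷ [] , λ ()
𝕎-returns-in-two (suc n) G = diagonal-via-const G zero identityPerm

perm∈U₁ : ∀ n (G : Quasigroup n) (W : Perm n) → InU₁ G (proj₁ W)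
perm∈U₁ zero    G W = 0 , [] , λ ()
perm∈U₁ (suc n) G W = 2 , diagonal-via-const G zero W

lemma3 : (n : ℕ) (G : Quasigroup n) →
    (∃[ p ] (IsPeriodU₁ G p × p ≤ 2))
    × (∀ (W : Perm n) → InU₁ G (proj₁ W))
    × (∀ (a : Fin n) → InU₁ G (const a))
lemma3 n G = period≤2 G (𝕎-returns-in-two n G) , perm∈U₁ n G , const∈U₁ G
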